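{- Let $N\geq1$, $q$ a prime power, $k\in\{0,1,\dots,N-1\}$, and let $\mathcal{K}$ be a higgledy-piggledy set of $k$-subspaces in $\mathrm{PG}(N,q)$. Let $\Sigma$ be a hyperplane and $P\notin\Sigma$ a point not contained in any element of $\mathcal{K}$. Then $\mathcal{K}':=\{\langle P,\kappa\rangle\cap\Sigma : \kappa\in\mathcal{K}\}$ is a higgledy-piggledy set of $k$-subspaces in $\Sigma\cong\mathrm{PG}(N-1,q)$ of size at most $|\mathcal{K}|$.
   Context: $\mathrm{PG}(N,q)$ denotes the Desarguesian projective space of dimension $N$ over $\mathbb{F}_q$. A strong $k$-blocking set of $\mathrm{PG}(M,q)$ is a point set meeting every $(M-k)$-subspace $\kappa$ in a set of points spanning $\kappa$. A set $\mathcal{K}$ of $k$-subspaces of $\mathrm{PG}(M,q)$ is a higgledy-piggledy set if the set of points lying in at least one element of $\mathcal{K}$ is a strong $k$-blocking set. $\langle\cdot\rangle$ denotes span. -}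

module Defs where

open import Level using (0ℓ)
open import Algebra.Bundles using (CommutativeRing)
open import Data.Nat using (ℕ; zero; suc; _^_; _∸_)
open import Data.Nat.Primality using (Prime)
open import Data.Fin using (Fin; zero; suc)
open import Data.Product using (Σ; ∃; ∃-syntax; _×_; _,_)
open import Data.Unit using (⊤)
open import Relation.Nullary using (¬_)
open import Relation.Binary.PropositionalEquality using (_≡_)

IsPrimePower : ℕ → Set
IsPrimePower q = ∃[ p ] ∃[ e ] (Prime p × q ≡ p ^ suc e)

record FiniteField (q : ℕ) : Set₁ where
  field
    commRing : CommutativeRing 0ℓ 0ℓ
  open CommutativeRing commRing public
  field
    0≉1     : ¬ (0# ≈ 1#)
    inverse : ∀ x → ¬ (x ≈ 0#) → ∃[ y ] (x * y ≈ 1#)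
    enum        : Fin q → Carrier
    enum-surj   : ∀ x → ∃[ i ] (enum i ≈ x)
    enum-inj    : ∀ i j → enum i ≈ enum j → i ≡ j

module Geometry {q : ℕ} (F : FiniteField q) where
  open FiniteField F hiding (zero)

  Vec : ℕ → Set
  Vec n = Fin n → Carrier

  _≈ᵥ_ : ∀ {n} → Vec n → Vec n → Set
  u ≈ᵥ v = ∀ i → u i ≈ v i

  0ᵥ : ∀ {n} → Vec n
  0ᵥ _ = 0#

  _+ᵥ_ : ∀ {n} → Vec n → Vec n → Vec n
  (u +ᵥ v) i = u i + v i

  _·ᵥ_ : ∀ {n} → Carrier → Vec n → Vec n
  (c ·ᵥ v) i = c * v i

  lincomb : ∀ {n} j → (Fin j → Carrier) → (Fin j → Vec n) → Vec n
  lincomb zero    c b = 0ᵥ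
  lincomb (suc j) c b = (c zero ·ᵥ b zero) +ᵥ lincomb j (λ l → c (suc l)) (λ l → b (suc l))

  InSpan : ∀ {n j} → (Fin j → Vec n) → Vec n → Set
  InSpan {j = j} b v = ∃[ c ] (lincomb j c b ≈ᵥ v)

  LinIndep : ∀ {n j} → (Fin j → Vec n) → Set
  LinIndep {j = j} b = ∀ c → lincomb j c b ≈ᵥ 0ᵥ → ∀ l → c l ≈ 0#

  NonZero : ∀ {n} → Vec n → Set
  NonZero v = ¬ (v ≈ᵥ 0ᵥ)

  -- A projective d-subspace of PG(n-1,q): span of d+1 independent vectors
  record Subspace (n d : ℕ) : Set where
    field
      basis : Fin (suc d) → Vec n
      indep : LinIndep basis

  _∈_ : ∀ {n d} → Vec n → Subspace n d → Set
  v ∈ S = InSpan (Subspace.basis S) v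

  -- Point sets: predicates on vectors (a nonzero v represents the point ⟨v⟩)
  PointSet : ℕ → Set₁
  PointSet n = Vec n → Set

  SpansIn : ∀ {n d} → PointSet n → Subspace n d → Set
  SpansIn {n} S κ =
    ∀ v → v ∈ κ →
      ∃[ j ] ∃[ w ] ((∀ (l : Fin j) → NonZero (w l) × S (w l) × w l ∈ κ)
                     × InSpan {n} {j} w v)

  -- Strong k-blocking set of an ambient projective space of dimension M,
  -- the ambient space given as a point predicate Amb (all vectors for
  -- PG(M,q) itself, or a subspace such as a hyperplane).
  StrongBlocking : ∀ {n} (Amb : PointSet n) (M k : ℕ) → PointSet n → Set
  StrongBlocking {n} Amb M k S =
    ∀ (κ : Subspace n (M ∸ k)) → (∀ v → v ∈ κ → Amb v) → SpansIn S κ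

  Covered : ∀ {n d m} → (Fin m → Subspace n d) → PointSet n
  Covered {m = m} K v = ∃[ i ] (v ∈ K i)

  HiggledyPiggledy : ∀ {n m} (Amb : PointSet n) (M k : ℕ) → (Fin m → Subspace n k) → Set
  HiggledyPiggledy Amb M k K =
    (∀ i v → v ∈ K i → Amb v) × StrongBlocking Amb M k (Covered K)

  Whole : ∀ {n} → PointSet n
  Whole _ = ⊤

  joinFamily : ∀ {n d} → Vec n → Subspace n d → Fin (suc (suc d)) → Vec n
  joinFamily P κ zero    = P
  joinFamily P κ (suc l) = Subspace.basis κ l

  InJoinMeet : ∀ {n d e} → Vec n → Subspace n d → Subspace n e → Vec n → Set
  InJoinMeet P κ Σ' v = InSpan (joinFamily P κ) v × v ∈ Σ'

-- Since Σ is spanned by N independent vectors of F^(N+1), P ∉ Σ, and any N + 2 vectors of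
-- F^(N+1) are dependent (Gaussian elimination), every vector splits as a P + s with s ∈ Σ, the
-- coefficient a being unique. Projecting a basis of κ ∈ 𝒦 from P onto Σ in this way gives a basis
-- of ⟨P, κ⟩ ∩ Σ, independent because P ∉ κ. For a subspace μ ⊆ Σ of the right dimension, ⟨P, μ⟩
-- is spanned by points of ∪𝒦; their projections are points of ∪𝒦′ in μ (nonzero since P lies in
-- no element of 𝒦), and they still span μ because the P-component of a vector of Σ is zero.

module Submission where

open import Defs
open import Data.Nat using (ℕ; zero; suc; _<_; _≤_; _∸_; s≤s)
open import Data.Nat.Properties using (+-∸-assoc)
open import Data.Fin using (Fin; zero; suc; punchIn)
open import Data.Fin.Properties using (any?)
open import Data.Vec.Functional using (_∷_; tail; insertAt)
open import Data.Vec.Functional.Properties using (insertAt-punchIn)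
open import Data.Product using (∃-syntax; _×_; _,_; proj₁; proj₂)
open import Data.Unit using (tt)
open import Data.Empty using (⊥-elim)
open import Function using (_∘_)
open import Relation.Nullary using (¬_; yes; no)
open import Relation.Nullary.Decidable using (¬?; decidable-stable)
open import Relation.Binary.Definitions using (Decidable)
open import Relation.Binary.PropositionalEquality as ≡ using (_≡_)
import Algebra.Solver.Ring.NaturalCoefficients.Default as SemiringSolver

module LinearAlgebra {q : ℕ} (F : FiniteField q) where
  open FiniteField F hiding (zero)
  open Geometry F
  open import Algebra.Properties.Ring ring using (-‿distribˡ-*; -‿distribʳ-*; -1*x≈-x)
  open import Algebra.Properties.Group +-group using (⁻¹-involutive; inverseʳ-unique; \\-leftDividesʳ; //-rightDividesʳ)
  open import Algebra.Properties.CommutativeSemigroup +-commutativeSemigroup using (x∙yz≈y∙xz)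
  open import Algebra.Properties.Monoid.Sum +-monoid using (sum-syntax)
  open SemiringSolver commutativeSemiring using (solve; _:=_; _:+_; _:*_)
  open import Relation.Binary.Reasoning.Setoid setoid

  _≟_ : Decidable _≈_
  x ≟ y with enum-surj x | enum-surj y
  ... | i , eᵢ≈x | j , eⱼ≈y with i Data.Fin.≟ j
  ... | yes ≡.refl = yes (trans (sym eᵢ≈x) eⱼ≈y)
  ... | no i≢j = no (λ x≈y → i≢j (enum-inj i j (trans eᵢ≈x (trans x≈y (sym eⱼ≈y)))))

  a*b≈1⇒b*[a*x]≈x : ∀ {a b} x → a * b ≈ 1# → b * (a * x) ≈ x
  a*b≈1⇒b*[a*x]≈x {a} {b} x ab≈1 = begin
    b * (a * x) ≈⟨ solve 3 (λ a b x → b :* (a :* x) := (a :* b) :* x) refl a b x ⟩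
    (a * b) * x ≈⟨ *-cong ab≈1 refl ⟩
    1# * x      ≈⟨ *-identityˡ x ⟩
    x           ∎

  c*b≈1∧c*x+z≈0⇒-b*z≈x : ∀ {b c x z} → c * b ≈ 1# → c * x + z ≈ 0# → - b * z ≈ x
  c*b≈1∧c*x+z≈0⇒-b*z≈x {b} {c} {x} {z} cb≈1 cx+z≈0 = begin
    - b * z              ≈⟨ *-cong refl (inverseʳ-unique (c * x) z cx+z≈0) ⟩
    - b * - (c * x)      ≈⟨ -‿distribˡ-* b _ ⟨
    - (b * - (c * x))    ≈⟨ -‿cong (-‿distribʳ-* b (c * x)) ⟨
    - - (b * (c * x))    ≈⟨ ⁻¹-involutive _ ⟩
    b * (c * x)          ≈⟨ a*b≈1⇒b*[a*x]≈x x cb≈1 ⟩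
    x                    ∎

  -x*y+[x*y+z]≈z : ∀ x y z → - x * y + (x * y + z) ≈ z
  -x*y+[x*y+z]≈z x y z = trans (+-cong (sym (-‿distribˡ-* x y)) refl) (\\-leftDividesʳ (x * y) z)

  lincomb-zeroᶜ : ∀ {n} j (b : Fin j → Vec n) → lincomb j (λ _ → 0#) b ≈ᵥ 0ᵥ
  lincomb-zeroᶜ zero    b i = refl
  lincomb-zeroᶜ (suc j) b i =
    trans (+-cong (zeroˡ (b zero i)) (lincomb-zeroᶜ j (tail b) i)) (+-identityʳ 0#)

  lincomb-+ᶜ : ∀ {n} j (c d : Fin j → Carrier) (b : Fin j → Vec n) →
               lincomb j (λ l → c l + d l) b ≈ᵥ (lincomb j c b +ᵥ lincomb j d b)
  lincomb-+ᶜ zero    c d b i = sym (+-identityʳ 0#)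
  lincomb-+ᶜ (suc j) c d b i =
    trans (+-cong refl (lincomb-+ᶜ j (tail c) (tail d) (tail b) i))
          (solve 5 (λ c₀ d₀ b₀ x y → (c₀ :+ d₀) :* b₀ :+ (x :+ y) := (c₀ :* b₀ :+ x) :+ (d₀ :* b₀ :+ y))
                 refl (c zero) (d zero) (b zero i) _ _)

  lincomb-*ᶜ : ∀ {n} j a (c : Fin j → Carrier) (b : Fin j → Vec n) →
               lincomb j (λ l → a * c l) b ≈ᵥ (a ·ᵥ lincomb j c b)
  lincomb-*ᶜ zero    a c b i = sym (zeroʳ a)
  lincomb-*ᶜ (suc j) a c b i =
    trans (+-cong refl (lincomb-*ᶜ j a (tail c) (tail b) i))
          (solve 4 (λ a c₀ b₀ x → a :* c₀ :* b₀ :+ a :* x := a :* (c₀ :* b₀ :+ x)) refl a (c zero) (b zero i) _)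

  lincomb-split : ∀ {n} j (c e : Fin j → Carrier) (P : Vec n) {w s : Fin j → Vec n} →
                  (∀ l → w l ≈ᵥ ((e l ·ᵥ P) +ᵥ s l)) →
                  lincomb j c w ≈ᵥ (((∑[ l < j ] (c l * e l)) ·ᵥ P) +ᵥ lincomb j c s)
  lincomb-split zero    c e P w≈ i = sym (trans (+-identityʳ _) (zeroˡ (P i)))
  lincomb-split (suc j) c e P w≈ i =
    trans (+-cong (*-cong refl (w≈ zero i)) (lincomb-split j (tail c) (tail e) P (w≈ ∘ suc) i))
          (solve 6 (λ c₀ e₀ p s₀ E S → c₀ :* (e₀ :* p :+ s₀) :+ (E :* p :+ S) := (c₀ :* e₀ :+ E) :* p :+ (c₀ :* s₀ :+ S))
                 refl (c zero) (e zero) (P i) _ _ _)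

  lincomb-insertAt : ∀ {n} j (d : Fin j → Carrier) p t (w : Fin (suc j) → Vec n) →
                     lincomb (suc j) (insertAt d p t) w ≈ᵥ ((t ·ᵥ w p) +ᵥ lincomb j d (w ∘ punchIn p))
  lincomb-insertAt j       d zero    t w i = refl
  lincomb-insertAt (suc j) d (suc p) t w i =
    trans (+-cong refl (lincomb-insertAt j (tail d) p t (tail w) i)) (x∙yz≈y∙xz _ _ _)

  lincomb-tail : ∀ {n} j c (w : Fin j → Vec (suc n)) i → lincomb j c w (suc i) ≡ lincomb j c (tail ∘ w) i
  lincomb-tail zero    c w i = ≡.refl
  lincomb-tail (suc j) c w i = ≡.cong (c zero * w zero (suc i) +_) (lincomb-tail j (tail c) (tail w) i)

  lincomb-vanishes : ∀ {n} j c (w : Fin j → Vec n) i → (∀ l → w l i ≈ 0#) → lincomb j c w i ≈ 0#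
  lincomb-vanishes zero    c w i w≈0 = refl
  lincomb-vanishes (suc j) c w i w≈0 =
    trans (+-cong (trans (*-cong refl (w≈0 zero)) (zeroʳ _)) (lincomb-vanishes j (tail c) (tail w) i (w≈0 ∘ suc)))
          (+-identityʳ 0#)

  span-cong : ∀ {n j} {b : Fin j → Vec n} {x y} → x ≈ᵥ y → InSpan b x → InSpan b y
  span-cong x≈y (c , c≈x) = c , λ i → trans (c≈x i) (x≈y i)

  span-0 : ∀ {n j} (b : Fin j → Vec n) → InSpan b 0ᵥ
  span-0 {j = j} b = (λ _ → 0#) , lincomb-zeroᶜ j b

  span-+ : ∀ {n j} {b : Fin j → Vec n} {x y} → InSpan b x → InSpan b y → InSpan b (x +ᵥ y)
  span-+ {j = j} {b} (c , c≈x) (d , d≈y) =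
    (λ l → c l + d l) , λ i → trans (lincomb-+ᶜ j c d b i) (+-cong (c≈x i) (d≈y i))

  span-· : ∀ {n j} {b : Fin j → Vec n} a {x} → InSpan b x → InSpan b (a ·ᵥ x)
  span-· {j = j} {b} a (c , c≈x) = (λ l → a * c l) , λ i → trans (lincomb-*ᶜ j a c b i) (*-cong refl (c≈x i))

  span-lincomb : ∀ {n j} (b : Fin j → Vec n) m c {w : Fin m → Vec n} → (∀ l → InSpan b (w l)) →
                 InSpan b (lincomb m c w)
  span-lincomb b zero    c w∈b = span-0 b
  span-lincomb b (suc m) c w∈b = span-+ (span-· (c zero) (w∈b zero)) (span-lincomb b m (tail c) (w∈b ∘ suc))

  ∉span⇒coeff≈0 : ∀ {n j} (σ : Fin j → Vec n) {P x y : Vec n} {a} → ¬ InSpan σ P →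
                  InSpan σ x → InSpan σ y → x ≈ᵥ ((a ·ᵥ P) +ᵥ y) → a ≈ 0#
  ∉span⇒coeff≈0 σ {P} {x} {y} {a} P∉σ x∈σ y∈σ x≈ with a ≟ 0#
  ... | yes a≈0 = a≈0
  ... | no  a≉0 = ⊥-elim (P∉σ (span-cong b·[x-y]≈P (span-· b (span-+ x∈σ (span-· (- 1#) y∈σ)))))
    where
      b = proj₁ (inverse a a≉0)
      b·[x-y]≈P : (b ·ᵥ (x +ᵥ ((- 1#) ·ᵥ y))) ≈ᵥ P
      b·[x-y]≈P i = begin
        b * (x i + - 1# * y i)          ≈⟨ *-cong refl (+-cong (x≈ i) (-1*x≈-x (y i))) ⟩
        b * ((a * P i + y i) + - y i)   ≈⟨ *-cong refl (//-rightDividesʳ (y i) (a * P i)) ⟩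
        b * (a * P i)                   ≈⟨ a*b≈1⇒b*[a*x]≈x (P i) (proj₂ (inverse a a≉0)) ⟩
        P i                             ∎

  ∉span⇒≈ᵥ : ∀ {n j} (σ : Fin j → Vec n) {P x y : Vec n} {a} → ¬ InSpan σ P →
             InSpan σ x → InSpan σ y → x ≈ᵥ ((a ·ᵥ P) +ᵥ y) → x ≈ᵥ y
  ∉span⇒≈ᵥ σ {P} P∉σ x∈σ y∈σ x≈ i =
    trans (x≈ i) (trans (+-cong (trans (*-cong (∉span⇒coeff≈0 σ P∉σ x∈σ y∈σ x≈) refl) (zeroˡ (P i))) refl)
                        (+-identityˡ _))

  Dependent : ∀ {n j} → (Fin j → Vec n) → Set
  Dependent {j = j} w = ∃[ c ] (lincomb j c w ≈ᵥ 0ᵥ × ∃[ l ] ¬ (c l ≈ 0#))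

  head≈0⇒trivial : ∀ {n j} c (w : Fin (suc j) → Vec n) → LinIndep (tail w) →
                   lincomb (suc j) c w ≈ᵥ 0ᵥ → c zero ≈ 0# → ∀ l → c l ≈ 0#
  head≈0⇒trivial c w tail-indep rel c₀≈0 zero    = c₀≈0
  head≈0⇒trivial c w tail-indep rel c₀≈0 (suc l) = tail-indep (tail c) tail-rel l
    where
      tail-rel : lincomb _ (tail c) (tail w) ≈ᵥ 0ᵥ
      tail-rel i = trans (sym (+-identityˡ _))
                         (trans (+-cong (sym (trans (*-cong c₀≈0 refl) (zeroˡ (w zero i)))) refl) (rel i))

  ∷-independent : ∀ {n j} (P : Vec n) (b : Fin j → Vec n) → ¬ InSpan b P → LinIndep b → LinIndep (P ∷ b)
  ∷-independent P b P∉b b-indep c rel = head≈0⇒trivial c (P ∷ b) b-indep rel c₀≈0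
    where
      c₀≈0 : c zero ≈ 0#
      c₀≈0 = ∉span⇒coeff≈0 b P∉b (span-0 b) (tail c , λ i → refl) (λ i → sym (rel i))

  dependent-∷⇒∈span : ∀ {n j} (x : Vec n) (w : Fin j → Vec n) → LinIndep w → Dependent (x ∷ w) → InSpan w x
  dependent-∷⇒∈span {j = j} x w w-indep (c , rel , l₀ , c≉0) with c zero ≟ 0#
  ... | yes c₀≈0 = ⊥-elim (c≉0 (head≈0⇒trivial c (x ∷ w) w-indep rel c₀≈0 l₀))
  ... | no  c₀≉0 = (λ l → - b * c (suc l)) , λ i →
          trans (lincomb-*ᶜ j (- b) (tail c) w i) (c*b≈1∧c*x+z≈0⇒-b*z≈x (proj₂ (inverse _ c₀≉0)) (rel i))
    where b = proj₁ (inverse _ c₀≉0)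

  pivot : ∀ {n m} (w : Fin (suc m) → Vec (suc n)) →
          ∃[ p ] ∃[ r ] (∀ l → r l * w p zero ≈ w (punchIn p l) zero)
  pivot w with any? (λ l → ¬? (w l zero ≟ 0#))
  ... | yes (p , wₚ≉0) = p , (λ l → w (punchIn p l) zero * b) , λ l →
          trans (solve 3 (λ x b y → x :* b :* y := x :* (y :* b)) refl _ b _)
                (trans (*-cong refl (proj₂ (inverse _ wₚ≉0))) (*-identityʳ _))
    where b = proj₁ (inverse _ wₚ≉0)
  ... | no  ∄pivot = zero , (λ _ → 0#) , λ l →
          trans (zeroˡ _) (sym (decidable-stable (w (suc l) zero ≟ 0#) (λ w≉0 → ∄pivot (suc l , w≉0))))

  clear : ∀ {n j} (w : Fin (suc j) → Vec n) (p : Fin (suc j)) (r : Fin j → Carrier) → Fin j → Vec n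
  clear w p r l = ((- r l) ·ᵥ w p) +ᵥ w (punchIn p l)

  -- Gaussian elimination: once the multiples r of the pivot w p clear the first coordinate,
  -- a relation among the cleared tails lifts to a relation among w.
  eliminate : ∀ {n j} (w : Fin (suc j) → Vec (suc n)) (p : Fin (suc j)) (r : Fin j → Carrier) →
              (∀ l → r l * w p zero ≈ w (punchIn p l) zero) →
              Dependent (tail ∘ clear w p r) → Dependent w
  eliminate {j = j} w p r rwₚ≈w (d , rel , l₀ , d≉0) = insertAt d p t , relation , punchIn p l₀ , insert≉0
    where
      t = ∑[ l < j ] (d l * - r l)
      clear-head≈0 : ∀ l → clear w p r l zero ≈ 0#
      clear-head≈0 l = trans (+-cong (trans (sym (-‿distribˡ-* _ _)) (-‿cong (rwₚ≈w l))) refl) (-‿inverseˡ _)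
      clear-relation : lincomb j d (clear w p r) ≈ᵥ 0ᵥ
      clear-relation zero    = lincomb-vanishes j d (clear w p r) zero clear-head≈0
      clear-relation (suc i) = trans (reflexive (lincomb-tail j d (clear w p r) i)) (rel i)
      relation : lincomb (suc j) (insertAt d p t) w ≈ᵥ 0ᵥ
      relation i = begin
        lincomb (suc j) (insertAt d p t) w i         ≈⟨ lincomb-insertAt j d p t w i ⟩
        t * w p i + lincomb j d (w ∘ punchIn p) i    ≈⟨ lincomb-split j d (λ l → - r l) (w p) (λ l i → refl) i ⟨
        lincomb j d (clear w p r) i                  ≈⟨ clear-relation i ⟩
        0#                                           ∎
      insert≉0 : ¬ (insertAt d p t (punchIn p l₀) ≈ 0#)
      insert≉0 = ≡.subst (λ x → ¬ (x ≈ 0#)) (≡.sym (insertAt-punchIn d p t l₀)) d≉0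

  dependent : ∀ n (w : Fin (suc n) → Vec n) → Dependent w
  dependent zero    w = (λ _ → 1#) , (λ ()) , zero , λ 1≈0 → 0≉1 (sym 1≈0)
  dependent (suc n) w with pivot w
  ... | p , r , rwₚ≈w = eliminate w p r rwₚ≈w (dependent n (tail ∘ clear w p r))

  JointlySpan : ∀ {n j} → Vec n → (Fin j → Vec n) → Set
  JointlySpan {n} P σ = ∀ (x : Vec n) → ∃[ a ] ∃[ s ] (InSpan σ s × x ≈ᵥ ((a ·ᵥ P) +ᵥ s))

  -- x, P and σ are n + 2 vectors of F^(n+1), while P ∷ σ is independent.
  hyperplane+point-span : ∀ {n} {σ : Fin n → Vec (suc n)} {P} → LinIndep σ → ¬ InSpan σ P → JointlySpan P σ
  hyperplane+point-span {n} {σ} {P} σ-indep P∉σ x =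
    decompose (dependent-∷⇒∈span x (P ∷ σ) (∷-independent P σ P∉σ σ-indep) (dependent (suc n) (x ∷ P ∷ σ)))
    where
      decompose : InSpan (P ∷ σ) x → ∃[ a ] ∃[ s ] (InSpan σ s × x ≈ᵥ ((a ·ᵥ P) +ᵥ s))
      decompose (c , c≈x) = c zero , lincomb n (tail c) σ , (tail c , λ i → refl) , λ i → sym (c≈x i)

  join : ∀ {n d} (P : Vec n) (κ : Subspace n d) → ¬ (P ∈ κ) → Subspace n (suc d)
  join P κ P∉κ = record { basis = joinFamily P κ ; indep = ∷-independent P (Subspace.basis κ) P∉κ (Subspace.indep κ) }

  ∈⇒∈join : ∀ {n d} (P : Vec n) (κ : Subspace n d) {v} → v ∈ κ → InSpan (joinFamily P κ) v
  ∈⇒∈join P κ (c , c≈v) = (0# ∷ c) , λ i → trans (+-cong (zeroˡ (P i)) refl) (trans (+-identityˡ _) (c≈v i))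

  module Projection {n e} (Σh : Subspace n e) {P : Vec n} (P∉Σ : ¬ (P ∈ Σh))
                    (split : JointlySpan P (Subspace.basis Σh)) where
    private
      σ = Subspace.basis Σh

    module _ {k} (K : Subspace n k) (P∉K : ¬ (P ∈ K)) where
      private
        b = Subspace.basis K
        a : Fin (suc k) → Carrier
        a l = proj₁ (split (b l))
        s : Fin (suc k) → Vec n
        s l = proj₁ (proj₂ (split (b l)))
        s∈Σ : ∀ l → s l ∈ Σh
        s∈Σ l = proj₁ (proj₂ (proj₂ (split (b l))))
        lincomb-b : ∀ c → lincomb (suc k) c b ≈ᵥ (((∑[ l < suc k ] (c l * a l)) ·ᵥ P) +ᵥ lincomb (suc k) c s)
        lincomb-b c = lincomb-split (suc k) c a P (λ l → proj₂ (proj₂ (proj₂ (split (b l)))))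

      project : Subspace n k
      project = record { basis = s ; indep = s-indep }
        where
          s-indep : LinIndep s
          s-indep c rel = Subspace.indep K c
            (∉span⇒≈ᵥ b P∉K (c , λ i → refl) (span-0 b) (λ i → trans (lincomb-b c i) (+-cong refl (rel i))))

      ∈-project⇒ : ∀ {v} → v ∈ project → InJoinMeet P K Σh v
      ∈-project⇒ {v} (c , c≈v) = (- A ∷ c , join≈v) , span-cong {b = σ} c≈v (span-lincomb σ (suc k) c s∈Σ)
        where
          A = ∑[ l < suc k ] (c l * a l)
          join≈v : ∀ i → - A * P i + lincomb (suc k) c b i ≈ v i
          join≈v i = trans (+-cong refl (lincomb-b c i)) (trans (-x*y+[x*y+z]≈z A (P i) _) (c≈v i))

      ∈-project⇐ : ∀ {v} → InJoinMeet P K Σh v → v ∈ project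
      ∈-project⇐ {v} ((c , c≈v) , v∈Σ) =
        tail c , λ i → sym (∉span⇒≈ᵥ σ P∉Σ v∈Σ (span-lincomb σ (suc k) (tail c) s∈Σ) v≈ i)
        where
          v≈ : v ≈ᵥ (((c zero + ∑[ l < suc k ] (tail c l * a l)) ·ᵥ P) +ᵥ lincomb (suc k) (tail c) s)
          v≈ i = trans (sym (c≈v i)) (trans (+-cong refl (lincomb-b (tail c) i))
            (solve 4 (λ c₀ p A S → c₀ :* p :+ (A :* p :+ S) := (c₀ :+ A) :* p :+ S) refl (c zero) (P i) _ _))

      project-point : ∀ {w x α} → w ∈ K → NonZero w → x ∈ Σh → w ≈ᵥ ((α ·ᵥ P) +ᵥ x) → NonZero x × x ∈ project
      project-point {w} {x} {α} (g , g≈w) w≉0 x∈Σ w≈ = x≉0 , ∈-project⇐ ((- α ∷ g , join≈x) , x∈Σ)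
        where
          join≈x : ∀ i → - α * P i + lincomb (suc k) g b i ≈ x i
          join≈x i = trans (+-cong refl (trans (g≈w i) (w≈ i))) (-x*y+[x*y+z]≈z α (P i) (x i))
          x≉0 : NonZero x
          x≉0 x≈0 = w≉0 (∉span⇒≈ᵥ b P∉K (g , g≈w) (span-0 b) (λ i → trans (w≈ i) (+-cong refl (x≈0 i))))

    project-spans : ∀ {m k d} (K : Fin m → Subspace n k) (P∉K : ∀ i → ¬ (P ∈ K i))
                    (κ : Subspace n d) (κ⊆Σ : ∀ v → v ∈ κ → v ∈ Σh) →
                    SpansIn (Covered K) (join P κ (P∉Σ ∘ κ⊆Σ P)) →
                    SpansIn (Covered (λ i → project (K i) (P∉K i))) κ
    project-spans K P∉K κ κ⊆Σ K-spans v v∈κ = transfer (K-spans v (∈⇒∈join P κ v∈κ))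
      where
        K′ = λ i → project (K i) (P∉K i)

        ProjectedPoint : Vec n → Set
        ProjectedPoint w = ∃[ α ] ∃[ x ] ((NonZero x × Covered K′ x × x ∈ κ) × w ≈ᵥ ((α ·ᵥ P) +ᵥ x))

        projectPoint : ∀ {w} → NonZero w × Covered K w × InSpan (joinFamily P κ) w → ProjectedPoint w
        projectPoint (w≉0 , (i , w∈K) , (c , c≈w)) =
          c zero , x , (proj₁ x-props , (i , proj₂ x-props) , x∈κ) , λ l → sym (c≈w l)
          where
            x = lincomb _ (tail c) (Subspace.basis κ)
            x∈κ : x ∈ κ
            x∈κ = tail c , λ _ → refl
            x-props = project-point (K i) (P∉K i) w∈K w≉0 (κ⊆Σ x x∈κ) (λ l → sym (c≈w l))

        transfer : ∃[ j ] ∃[ w ] ((∀ (l : Fin j) → NonZero (w l) × Covered K (w l) × InSpan (joinFamily P κ) (w l)) × InSpan w v) →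
                   ∃[ j ] ∃[ x ] ((∀ (l : Fin j) → NonZero (x l) × Covered K′ (x l) × x l ∈ κ) × InSpan x v)
        transfer (j , w , w-props , (c , c≈v)) = j , x , x-props , (c , λ i → sym (v≈ i))
          where
            α = λ l → proj₁ (projectPoint (w-props l))
            x = λ l → proj₁ (proj₂ (projectPoint (w-props l)))
            x-props = λ l → proj₁ (proj₂ (proj₂ (projectPoint (w-props l))))
            w≈ = λ l → proj₂ (proj₂ (proj₂ (projectPoint (w-props l))))
            v≈ : v ≈ᵥ lincomb j c x
            v≈ = ∉span⇒≈ᵥ σ P∉Σ (κ⊆Σ v v∈κ) (span-lincomb σ j c (λ l → κ⊆Σ (x l) (proj₂ (proj₂ (x-props l)))))
                   (λ i → trans (sym (c≈v i)) (lincomb-split j c α P w≈ i))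

mainTheorem18 : (N q k m : ℕ) → 1 ≤ N → IsPrimePower q → (F : FiniteField q) →
    let open Geometry F in
    k < N →
    (K : Fin m → Subspace (suc N) k) →
    HiggledyPiggledy Whole N k K →
    (Σh : Subspace (suc N) (N ∸ 1)) →
    (P : Vec (suc N)) → NonZero P → ¬ (P ∈ Σh) →
    (∀ i → ¬ (P ∈ K i)) →
    ∃[ K′ ] (((i : Fin m) (v : Vec (suc N)) →
    (v ∈ K′ i → InJoinMeet P (K i) Σh v)
    × (InJoinMeet P (K i) Σh v → v ∈ K′ i))
    × HiggledyPiggledy (λ v → v ∈ Σh) (N ∸ 1) k K′)
mainTheorem18 (suc N) _ k _ _ _ F (s≤s k≤N) K (_ , K-blocking) Σh P _ P∉Σ P∉K =
  K′ , (λ i v → ∈-project⇒ (K i) (P∉K i) , ∈-project⇐ (K i) (P∉K i)) ,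
  (λ i v v∈K′ → proj₂ (∈-project⇒ (K i) (P∉K i) v∈K′)) ,
  λ κ κ⊆Σ → project-spans K P∉K κ κ⊆Σ (K-spans-joins (join P κ (P∉Σ ∘ κ⊆Σ P)))
  where
    open Geometry F
    open LinearAlgebra F
    open Projection Σh P∉Σ (hyperplane+point-span {σ = Subspace.basis Σh} (Subspace.indep Σh) P∉Σ)
    K′ = λ i → project (K i) (P∉K i)
    K-spans-joins : (J : Subspace (suc (suc N)) (suc (N ∸ k))) → SpansIn (Covered K) J
    K-spans-joins = ≡.subst (λ d → (J : Subspace (suc (suc N)) d) → SpansIn (Covered K) J)
                            (+-∸-assoc 1 k≤N) (λ J → K-blocking J (λ _ _ → tt))
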